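{- Let $(s,h_1),(s,h_2)$ be models with $h_1\uplus^s h_2\neq\bot$. Then $\mathrm{abst}(s,h_1\uplus^s h_2)=\mathrm{abst}(s,h_1)\odot\mathrm{abst}(s,h_2)$.
   Context: $\mathrm{Loc}$ is an infinite set of locations, $\mathrm{Var}$ an infinite set of variables containing $\mathsf{nil}$. A stack is a partial function $s:\mathrm{Var}\rightharpoonup\mathrm{Loc}$; a heap is a finite partial function $h:\mathrm{Loc}\rightharpoonup\mathrm{Loc}$; a model is $(s,h)$ with $\mathsf{nil}\in\mathrm{dom}(s)$, $s(\mathsf{nil})\notin\mathrm{dom}(h)$. $\mathrm{locs}(h)=\mathrm{dom}(h)\cup\mathrm{img}(h)$; $h_1\uplus^s h_2:=h_1\cup h_2$ if $\mathrm{dom}(h_1)\cap\mathrm{dom}(h_2)=\emptyset$ and $\mathrm{locs}(h_1)\cap\mathrm{locs}(h_2)\subseteq\mathrm{img}(s)$, else undefined ($\bot$). Atomic formulas: $\mathsf{emp}$, $x\mapsto y$, $\mathsf{ls}(x,y)$, $x=y$, $x\neq y$ with (strong) semantics: $\mathsf{emp}$ holds iff $\mathrm{dom}(h)=\emptyset$; $x=y$ (resp. $x\neq y$) iff $\mathrm{dom}(h)=\emptyset$ and $s(x)=s(y)$ (resp. $\neq$); $x\mapsto y$ iff $h=\{s(x)\mapsto s(y)\}$; $\mathsf{ls}(x,y)$ iff either $\mathrm{dom}(h)=\emptyset$ and $s(x)=s(y)$, or $h=\{l_0\mapsto l_1,\dots,l_{n-1}\mapsto l_n\}$ for some $n\ge1$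 with $s(x)=l_0$, $s(y)=l_n$; $\neg$, $\wedge$ classical. Chunks: $h'$ is a sub-heap of $h$ if $h=h'\uplus^s h''$ for some $h''$. A chunk of $(s,h)$ is a nonempty sub-heap $h_c$ such that no sub-heap $h'$ of $h$ satisfies $\emptyset\neq h'\subsetneq h_c$; positive if $(s,h_c)\models\tau$ for some atomic $\tau$, negative otherwise. An abstract memory state (AMS) is a quadruple $\langle V,E,R,\gamma\rangle$ where $V$ is a partition of a finite set of variables into nonempty blocks, $E:V\rightharpoonup V\times\{{=}1,{\ge}2\}$ is a partial function with no block of $\mathrm{dom}(E)$ containing $\mathsf{nil}$, $R$ is a set of pairwise disjoint subsets of $V$ each disjoint from $\mathrm{dom}(E)$ and containing no block with $\mathsf{nil}$, and $\gamma\in\mathbb{N}$. $\mathrm{alloc}(A)=\mathrm{dom}(E)\cup\bigcup R$. Induced AMS: $[x]_s=\{y\in\mathrm{dom}(s):s(y)=s(x)\}$, $\mathrm{cls}(s)=\{[x]_s\}$. $E_{s,h}([x]_s)=([y]_s,{=}1)$ if some $y\in\mathrm{dom}(s)$ and positive chunk $h_c$ satisfy $(s,h_c)\models x\mapsto y$; $=([y]_s,{\ge}2)$ if some $y$ and positive chunk satisfy $(s,h_c)\models\mathsf{ls}(x,y)\wedge\neg x\mapsto y$; undefined otherwise. $R_{s,h}=\{\{[x]_s:s(x)\in\mathrm{dom}(h_c)\}:h_c\text{ negative chunk}\}\setminus\{\emptyset\}$. $\mathrm{abst}(s,h)=\langle\mathrm{cls}(s),E_{s,h},R_{s,h},\gamma\rangle$,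 $\gamma$ = number of negative chunks $-|R_{s,h}|$. Composition: AMSs $A_i=\langle V_i,E_i,R_i,\gamma_i\rangle$ are compatible if $V_1=V_2$ and $\mathrm{alloc}(A_1)\cap\mathrm{alloc}(A_2)=\emptyset$; then $A_1\odot A_2=\langle V_1,E_1\cup E_2,R_1\cup R_2,\gamma_1+\gamma_2\rangle$, and $A_1\odot A_2=\bot$ otherwise. -}

module Defs where

open import Level using (Level; _⊔_) renaming (suc to lsuc)
open import Data.Nat using (ℕ; zero; suc; _+_; _<_; _≥_)
open import Data.Fin using (Fin)
open import Data.Maybe using (Maybe; just; nothing)
open import Data.Product using (Σ; _×_; _,_)
open import Data.Sum using (_⊎_)
open import Data.Empty using (⊥)
open import Data.List using (List)
open import Data.List.Membership.Propositional using (_∈_)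
open import Relation.Nullary using (¬_)
open import Relation.Binary.PropositionalEquality using (_≡_; _≢_)
open import Function.Definitions using (Injective)

_⇔_ : ∀ {a b} → Set a → Set b → Set (a ⊔ b)
P ⇔ Q = (P → Q) × (Q → P)

InfiniteSet : Set → Set
InfiniteSet X = Σ (ℕ → X) λ f → Injective _≡_ _≡_ f

HasCard : ∀ {a ℓ p} {A : Set a} → (A → A → Set ℓ) → (A → Set p) → ℕ → Set (a ⊔ ℓ ⊔ p)
HasCard {A = A} _≈_ P n =
  Σ (Fin n → A) λ f →
    (∀ i → P (f i)) ×
    (∀ i j → f i ≈ f j → i ≡ j) ×
    (∀ a → P a → Σ (Fin n) λ i → a ≈ f i)

data Lbl : Set where
  eq1 : Lbl
  geq2 : Lbl

module SL (Loc Var : Set) (nil : Var) where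

  Stack : Set
  Stack = Var → Maybe Loc

  -- heaps: partial functions Loc ⇀ Loc (finiteness is the predicate FiniteHeap)
  Heap : Set
  Heap = Loc → Maybe Loc

  dom : Heap → Loc → Set
  dom h l = Σ Loc λ v → h l ≡ just v

  img : Heap → Loc → Set
  img h l = Σ Loc λ l' → h l' ≡ just l

  locs : Heap → Loc → Set
  locs h l = dom h l ⊎ img h l

  imgS : Stack → Loc → Set
  imgS s l = Σ Var λ x → s x ≡ just l

  FiniteHeap : Heap → Set
  FiniteHeap h = Σ (List Loc) λ ls → ∀ l → dom h l → l ∈ ls

  Model : Stack → Heap → Set
  Model s h = FiniteHeap h × (Σ Loc λ l → s nil ≡ just l × h l ≡ nothing)

  _≗ʰ_ : Heap → Heap → Set
  h ≗ʰ h' = ∀ l → h l ≡ h' l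

  _⊆ʰ_ : Heap → Heap → Set
  h ⊆ʰ h' = ∀ l v → h l ≡ just v → h' l ≡ just v

  -- the union h₁ ∪ h₂ (left-biased; only used when domains are disjoint)
  _∪ʰ_ : Heap → Heap → Heap
  (h₁ ∪ʰ h₂) l with h₁ l
  ... | just v = just v
  ... | nothing = h₂ l

  -- h₁ ⊎^s h₂ ≠ ⊥
  SepDefined : Stack → Heap → Heap → Set
  SepDefined s h₁ h₂ =
    (∀ l → dom h₁ l → dom h₂ l → ⊥) ×
    (∀ l → locs h₁ l → locs h₂ l → imgS s l)

  SubHeap : Stack → Heap → Heap → Set
  SubHeap s h' h = Σ Heap λ h'' → SepDefined s h' h'' × (h ≗ʰ (h' ∪ʰ h''))

  NonEmpty : Heap → Set
  NonEmpty h = Σ Loc λ l → dom h l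

  Chunk : Stack → Heap → Heap → Set
  Chunk s h hc =
    SubHeap s hc h × NonEmpty hc ×
    ¬ (Σ Heap λ h' → SubHeap s h' h × NonEmpty h' × h' ⊆ʰ hc × ¬ (h' ≗ʰ hc))

  data Atom : Set where
    emp  : Atom
    _↦_  : Var → Var → Atom
    ls   : Var → Var → Atom
    _=ₐ_ : Var → Var → Atom
    _≠ₐ_ : Var → Var → Atom

  Emp : Heap → Set
  Emp h = ∀ l → ¬ dom h l

  _,_⊨_ : Stack → Heap → Atom → Set
  s , h ⊨ emp = Emp h
  s , h ⊨ (x ↦ y) = Σ Loc λ l → Σ Loc λ l' →
    s x ≡ just l × s y ≡ just l' × h l ≡ just l' × (∀ m → dom h m → m ≡ l)
  s , h ⊨ ls x y =
    (Emp h × Σ Loc λ l → s x ≡ just l × s y ≡ just l) ⊎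
    (Σ ℕ λ n → Σ (ℕ → Loc) λ ℓ →
       n ≥ 1 × s x ≡ just (ℓ 0) × s y ≡ just (ℓ n) ×
       (∀ i → i < n → h (ℓ i) ≡ just (ℓ (suc i))) ×
       (∀ m → dom h m → Σ ℕ λ i → i < n × m ≡ ℓ i))
  s , h ⊨ (x =ₐ y) = Emp h × Σ Loc λ l → s x ≡ just l × s y ≡ just l
  s , h ⊨ (x ≠ₐ y) = Emp h × Σ Loc λ l → Σ Loc λ l' →
    s x ≡ just l × s y ≡ just l' × l ≢ l'

  PosChunk : Stack → Heap → Heap → Set
  PosChunk s h hc = Chunk s h hc × Σ Atom λ τ → s , hc ⊨ τ

  NegChunk : Stack → Heap → Heap → Set
  NegChunk s h hc = Chunk s h hc × ¬ (Σ Atom λ τ → s , hc ⊨ τ)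

  Block : Set₁
  Block = Var → Set

  _≐_ : Block → Block → Set
  b ≐ b' = ∀ y → b y ⇔ b' y

  BlockSet : Set₁
  BlockSet = Block → Set

  _≐₂_ : BlockSet → BlockSet → Set₁
  S ≐₂ S' = ∀ b → S b ⇔ S' b

  cls : Stack → Var → Block
  cls s x y = Σ Loc λ l → s x ≡ just l × s y ≡ just l

  inDom : Stack → Var → Set
  inDom s x = Σ Loc λ l → s x ≡ just l

  Cls : Stack → BlockSet
  Cls s b = Σ Var λ x → inDom s x × b ≐ cls s x

  record AMS : Set₂ where
    field
      V : BlockSet
      E : Block → Block → Lbl → Set
      R : BlockSet → Set₁
      γ : ℕ
  open AMS public

  Eind : Stack → Heap → Block → Block → Lbl → Set
  Eind s h b b' eq1 = Σ Var λ x → Σ Var λ y →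
    inDom s x × inDom s y × b ≐ cls s x × b' ≐ cls s y ×
    Σ Heap λ hc → PosChunk s h hc × s , hc ⊨ (x ↦ y)
  Eind s h b b' geq2 = Σ Var λ x → Σ Var λ y →
    inDom s x × inDom s y × b ≐ cls s x × b' ≐ cls s y ×
    Σ Heap λ hc → PosChunk s h hc × (s , hc ⊨ ls x y) × ¬ (s , hc ⊨ (x ↦ y))

  chunkBlocks : Stack → Heap → BlockSet
  chunkBlocks s hc b = Σ Var λ x → b ≐ cls s x × Σ Loc λ l → s x ≡ just l × dom hc l

  Rind : Stack → Heap → BlockSet → Set₁
  Rind s h S = Σ Heap λ hc → NegChunk s h hc × S ≐₂ chunkBlocks s hc × Σ Block λ b → S b

  -- A = abst(s , h):  components agree with cls(s), E_{s,h}, R_{s,h}, and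
  -- γ = (#negative chunks) − |R_{s,h}|, i.e. #neg = γ + |R_{s,h}|.
  Abst : Stack → Heap → AMS → Set₁
  Abst s h A =
    (∀ b → V A b ⇔ Cls s b) ×
    (∀ b b' l → E A b b' l ⇔ Eind s h b b' l) ×
    (∀ S → R A S ⇔ Rind s h S) ×
    Σ ℕ λ n → Σ ℕ λ k →
      HasCard _≗ʰ_ (NegChunk s h) n × HasCard _≐₂_ (Rind s h) k × n ≡ γ A + k

  Alloc : AMS → Block → Set₁
  Alloc A b = (Σ Block λ b' → Σ Lbl λ l → E A b b' l) ⊎ (Σ BlockSet λ S → R A S × S b)

  Compatible : AMS → AMS → Set₁
  Compatible A₁ A₂ =
    (∀ b → V A₁ b ⇔ V A₂ b) ×
    (∀ b b' → b ≐ b' → Alloc A₁ b → Alloc A₂ b' → ⊥)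

  -- A₁ ⊙ A₂ (meaningful when Compatible A₁ A₂)
  _⊙_ : AMS → AMS → AMS
  A₁ ⊙ A₂ = record
    { V = V A₁
    ; E = λ b b' l → E A₁ b b' l ⊎ E A₂ b b' l
    ; R = λ S → R A₁ S ⊎ R A₂ S
    ; γ = γ A₁ + γ A₂
    }

-- A chunk of h₁ ⊎ˢ h₂ lies entirely inside h₁ or entirely inside h₂: its restriction to
-- dom h₁ is again a sub-heap, so by minimality it is either empty or the whole chunk.
-- Conversely, sub-heaps of a sub-heap are sub-heaps, so the chunks of h₁ ⊎ˢ h₂ are exactly
-- the chunks of h₁ together with those of h₂.  Every component of abst(s, h) is read off
-- the chunks of h, and chunks of h₁ and h₂ have disjoint domains, so each component of the
-- abstraction of the union is the disjoint union of the components for h₁ and h₂.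
module Submission where

open import Defs
open import Data.Product as Product using (Σ; _×_; _,_; proj₁; proj₂)
open import Function using (id)
open import Data.Sum as Sum using (_⊎_; inj₁; inj₂; [_,_]′)
open import Data.Maybe using (just; nothing)
open import Data.Maybe.Properties using (just-injective)
open import Data.Empty using (⊥; ⊥-elim)
open import Data.Nat using (_+_)
open import Data.Nat.Properties using (+-commutativeSemigroup)
open import Algebra.Properties.CommutativeSemigroup +-commutativeSemigroup using (interchange)
open import Data.Fin using (Fin; splitAt; join)
open import Data.Fin.Properties using (splitAt-join; join-splitAt)
open import Data.List.Relation.Unary.Any using (any?; satisfied)
open import Data.List.Membership.Propositional using (lose)
open import Relation.Nullary using (¬_; Dec; yes; no)
open import Relation.Nullary.Decidable using (_×-dec_; map′)
open import Relation.Binary.Definitions using (Symmetric)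
open import Relation.Binary.PropositionalEquality

⇔-sym : ∀ {a b} {P : Set a} {Q : Set b} → P ⇔ Q → Q ⇔ P
⇔-sym (f , g) = g , f

⇔-trans : ∀ {a b c} {P : Set a} {Q : Set b} {R : Set c} → P ⇔ Q → Q ⇔ R → P ⇔ R
⇔-trans (f , g) (f′ , g′) = (λ p → f′ (f p)) , (λ r → g (g′ r))

⊎-cong-⇔ : ∀ {a b c d} {P : Set a} {Q : Set b} {P′ : Set c} {Q′ : Set d} →
           P ⇔ P′ → Q ⇔ Q′ → (P ⊎ Q) ⇔ (P′ ⊎ Q′)
⊎-cong-⇔ (f , g) (f′ , g′) = Sum.map f f′ , Sum.map g g′

module _ {a ℓ p q u} {A : Set a} {_≈_ : A → A → Set ℓ}
         {P : A → Set p} {Q : A → Set q} {U : A → Set u} where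

  HasCard-⊎ : ∀ {n m} → Symmetric _≈_ → (∀ {x y} → P x → Q y → ¬ x ≈ y) →
              (∀ x → U x ⇔ (P x ⊎ Q x)) →
              HasCard _≈_ P n → HasCard _≈_ Q m → HasCard _≈_ U (n + m)
  HasCard-⊎ {n} {m} sym≈ P#Q U⇔ (f , f∈P , f-inj , f-onto) (g , g∈Q , g-inj , g-onto) =
    (λ i → fg (splitAt n i)) , (λ i → fg∈U (splitAt n i)) , injective , onto
    where
    fg : Fin n ⊎ Fin m → A
    fg = [ f , g ]′

    fg∈U : ∀ i → U (fg i)
    fg∈U (inj₁ i) = proj₂ (U⇔ _) (inj₁ (f∈P i))
    fg∈U (inj₂ i) = proj₂ (U⇔ _) (inj₂ (g∈Q i))

    fg-injective : ∀ i j → fg i ≈ fg j → i ≡ j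
    fg-injective (inj₁ i) (inj₁ j) e = cong inj₁ (f-inj i j e)
    fg-injective (inj₂ i) (inj₂ j) e = cong inj₂ (g-inj i j e)
    fg-injective (inj₁ i) (inj₂ j) e = ⊥-elim (P#Q (f∈P i) (g∈Q j) e)
    fg-injective (inj₂ i) (inj₁ j) e = ⊥-elim (P#Q (f∈P j) (g∈Q i) (sym≈ e))

    fg-onto : ∀ x → U x → Σ (Fin n ⊎ Fin m) λ i → x ≈ fg i
    fg-onto x ux = [ (λ px → Product.map inj₁ id (f-onto x px)) ,
                     (λ qx → Product.map inj₂ id (g-onto x qx)) ]′ (proj₁ (U⇔ x) ux)

    injective : ∀ i j → fg (splitAt n i) ≈ fg (splitAt n j) → i ≡ j
    injective i j e = begin
      i                      ≡⟨ join-splitAt n m i ⟨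
      join n m (splitAt n i) ≡⟨ cong (join n m) (fg-injective (splitAt n i) (splitAt n j) e) ⟩
      join n m (splitAt n j) ≡⟨ join-splitAt n m j ⟩
      j                      ∎
      where open ≡-Reasoning

    onto : ∀ x → U x → Σ (Fin (n + m)) λ i → x ≈ fg (splitAt n i)
    onto x ux with fg-onto x ux
    ... | i , x≈ = join n m i , subst (λ j → x ≈ fg j) (sym (splitAt-join n m i)) x≈

module Abstraction (Loc Var : Set) (nil : Var) where
  open SL Loc Var nil

  private
    variable
      s : Stack
      h h′ h″ h₁ h₂ ha hb hc hx w : Heap
      b b′ : Block
      A₁ A₂ : AMS

  _⊆ʰ_⊎ʰ_ : Heap → Heap → Heap → Set
  w ⊆ʰ h₁ ⊎ʰ h₂ = ∀ l v → w l ≡ just v → h₁ l ≡ just v ⊎ h₂ l ≡ just v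

  SharedInStack : Stack → Heap → Heap → Set
  SharedInStack s h₁ h₂ = ∀ l → locs h₁ l → locs h₂ l → imgS s l

  _∖ʰ_ : Heap → Heap → Heap
  (h ∖ʰ h′) l with h′ l
  ... | just _  = nothing
  ... | nothing = h l

  _↾ʰ_ : Heap → Heap → Heap
  (h ↾ʰ h′) l with h′ l
  ... | just _  = h l
  ... | nothing = nothing

  nothing≢just : ∀ {v : Loc} → nothing ≢ just v
  nothing≢just ()

  ⊆ʰ-trans : h ⊆ʰ h′ → h′ ⊆ʰ h″ → h ⊆ʰ h″
  ⊆ʰ-trans p q l v e = q l v (p l v e)

  ⊆ʰ-∪ʰˡ : ∀ h₁ h₂ → h₁ ⊆ʰ (h₁ ∪ʰ h₂)
  ⊆ʰ-∪ʰˡ h₁ h₂ l v e rewrite e = refl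

  ∪ʰ-nothingˡ : ∀ h₁ h₂ {l} → h₁ l ≡ nothing → (h₁ ∪ʰ h₂) l ≡ h₂ l
  ∪ʰ-nothingˡ h₁ h₂ e rewrite e = refl

  ∪ʰ-⊆ʰ-⊎ʰ : ∀ h₁ h₂ → (h₁ ∪ʰ h₂) ⊆ʰ h₁ ⊎ʰ h₂
  ∪ʰ-⊆ʰ-⊎ʰ h₁ h₂ l v e with h₁ l
  ... | just _  = inj₁ e
  ... | nothing = inj₂ e

  ∪ʰ-comm : ∀ h₁ h₂ → (∀ l → dom h₁ l → dom h₂ l → ⊥) → (h₁ ∪ʰ h₂) ≗ʰ (h₂ ∪ʰ h₁)
  ∪ʰ-comm h₁ h₂ disjoint l with h₁ l in e₁ | h₂ l in e₂
  ... | just u  | just v  = ⊥-elim (disjoint l (u , e₁) (v , e₂))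
  ... | just _  | nothing = sym e₁
  ... | nothing | just _  = e₂
  ... | nothing | nothing = trans e₂ (sym e₁)

  ∖ʰ-just : ∀ h h′ {l v} → (h ∖ʰ h′) l ≡ just v → h′ l ≡ nothing × h l ≡ just v
  ∖ʰ-just h h′ {l} e with h′ l
  ... | nothing = refl , e

  ∖ʰ-nothing⁺ : ∀ h h′ {l} → h′ l ≡ nothing → (h ∖ʰ h′) l ≡ h l
  ∖ʰ-nothing⁺ h h′ e rewrite e = refl

  ⊆ʰ⇒≗ʰ-∪ʰ-∖ʰ : h′ ⊆ʰ h → h ≗ʰ (h′ ∪ʰ (h ∖ʰ h′))
  ⊆ʰ⇒≗ʰ-∪ʰ-∖ʰ {h′} {h} h′⊆h l with h′ l in e
  ... | just v  = h′⊆h l v e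
  ... | nothing = sym (∖ʰ-nothing⁺ h h′ e)

  ↾ʰ-just⁺ : ∀ h h′ {l v} → dom h′ l → h l ≡ just v → (h ↾ʰ h′) l ≡ just v
  ↾ʰ-just⁺ h h′ {l} (_ , e) e′ rewrite e = e′

  ↾ʰ-nothing⁺ : ∀ h h′ {l} → h′ l ≡ nothing → (h ↾ʰ h′) l ≡ nothing
  ↾ʰ-nothing⁺ h h′ e rewrite e = refl

  ↾ʰ-nothing : ∀ h h′ {l v} → (h ↾ʰ h′) l ≡ nothing → h l ≡ just v → h′ l ≡ nothing
  ↾ʰ-nothing h h′ {l} e e′ with h′ l
  ... | just _  = ⊥-elim (nothing≢just (trans (sym e) e′))
  ... | nothing = refl

  ↾ʰ-just : ∀ h h′ {l v} → (h ↾ʰ h′) l ≡ just v → dom h′ l × h l ≡ just v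
  ↾ʰ-just h h′ {l} e with h′ l
  ... | just u = (u , refl) , e

  ↾ʰ-⊆ʰ : ∀ h h′ → (h ↾ʰ h′) ⊆ʰ h
  ↾ʰ-⊆ʰ h h′ l v e = proj₂ (↾ʰ-just h h′ e)

  locs-mono : h ⊆ʰ h′ → ∀ l → locs h l → locs h′ l
  locs-mono h⊆h′ l (inj₁ (v , e))  = inj₁ (v , h⊆h′ l v e)
  locs-mono h⊆h′ l (inj₂ (l′ , e)) = inj₂ (l′ , h⊆h′ l′ l e)

  locs-⊎ : w ⊆ʰ h₁ ⊎ʰ h₂ → ∀ l → locs w l → locs h₁ l ⊎ locs h₂ l
  locs-⊎ cover l (inj₁ (v , e)) =
    Sum.map (λ e′ → inj₁ (v , e′)) (λ e′ → inj₁ (v , e′)) (cover l v e)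
  locs-⊎ cover l (inj₂ (l′ , e)) =
    Sum.map (λ e′ → inj₂ (l′ , e′)) (λ e′ → inj₂ (l′ , e′)) (cover l′ l e)

  sharedInStack-monoˡ : h ⊆ʰ h′ → SharedInStack s h′ w → SharedInStack s h w
  sharedInStack-monoˡ h⊆h′ shared l p q = shared l (locs-mono h⊆h′ l p) q

  sharedInStack-monoʳ : w ⊆ʰ h′ → SharedInStack s h h′ → SharedInStack s h w
  sharedInStack-monoʳ w⊆h′ shared l p q = shared l p (locs-mono w⊆h′ l q)

  sharedInStack-⊎ : SharedInStack s h h₁ → SharedInStack s h h₂ → w ⊆ʰ h₁ ⊎ʰ h₂ →
                    SharedInStack s h w
  sharedInStack-⊎ shared₁ shared₂ cover l p q = [ shared₁ l p , shared₂ l p ]′ (locs-⊎ cover l q)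

  SepDefined-sym : SepDefined s h₁ h₂ → SepDefined s h₂ h₁
  SepDefined-sym (disjoint , shared) = (λ l d₂ d₁ → disjoint l d₁ d₂) , (λ l q p → shared l p q)

  subHeap⇒⊆ʰ : SubHeap s h′ h → h′ ⊆ʰ h
  subHeap⇒⊆ʰ {h′ = h′} (h″ , _ , h≗) l v e = trans (h≗ l) (⊆ʰ-∪ʰˡ h′ h″ l v e)

  complement-just : ∀ h′ h″ → h ≗ʰ (h′ ∪ʰ h″) → ∀ {l v} → h′ l ≡ nothing → h l ≡ just v →
                    h″ l ≡ just v
  complement-just h′ h″ h≗ {l} h′≡nothing h≡v =
    trans (sym (∪ʰ-nothingˡ h′ h″ h′≡nothing)) (trans (sym (h≗ l)) h≡v)

  subHeap-complement : h′ ⊆ʰ h → SharedInStack s h′ (h ∖ʰ h′) → SubHeap s h′ h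
  subHeap-complement {h′} {h} h′⊆h shared = h ∖ʰ h′ , (disjoint , shared) , ⊆ʰ⇒≗ʰ-∪ʰ-∖ʰ h′⊆h
    where
    disjoint : ∀ l → dom h′ l → dom (h ∖ʰ h′) l → ⊥
    disjoint l (v , e) (_ , e′) = nothing≢just (trans (sym (proj₁ (∖ʰ-just h h′ e′))) e)

  subHeap-shrink : SubHeap s h′ h → h′ ⊆ʰ hx → hx ⊆ʰ h → SubHeap s h′ hx
  subHeap-shrink {h′ = h′} {hx = hx} (h″ , (_ , shared) , h≗) h′⊆hx hx⊆h =
    subHeap-complement h′⊆hx (sharedInStack-monoʳ hx∖h′⊆h″ shared)
    where
    hx∖h′⊆h″ : (hx ∖ʰ h′) ⊆ʰ h″
    hx∖h′⊆h″ l v e = let h′≡nothing , hx≡v = ∖ʰ-just hx h′ e in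
      complement-just h′ h″ h≗ h′≡nothing (hx⊆h l v hx≡v)

  subHeap-trans : SubHeap s h h′ → SubHeap s h′ h″ → SubHeap s h h″
  subHeap-trans {h = h} {h′} {h″} sub@(k , (_ , shared) , h′≗) sub′@(k′ , (_ , shared′) , h″≗) =
    subHeap-complement (⊆ʰ-trans h⊆h′ (subHeap⇒⊆ʰ sub′))
      (sharedInStack-⊎ shared (sharedInStack-monoˡ h⊆h′ shared′) cover)
    where
    h⊆h′ : h ⊆ʰ h′
    h⊆h′ = subHeap⇒⊆ʰ sub
    cover : (h″ ∖ʰ h) ⊆ʰ k ⊎ʰ k′
    cover l v e with ∖ʰ-just h″ h e
    ... | h≡nothing , h″≡v =
      Sum.map (complement-just h k h′≗ h≡nothing) id (∪ʰ-⊆ʰ-⊎ʰ h′ k′ l v (trans (sym (h″≗ l)) h″≡v))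

  subHeap-↾ʰ : SubHeap s ha h → SubHeap s hc h → SubHeap s (hc ↾ʰ ha) h
  subHeap-↾ʰ {ha = ha} {h} {hc} subₐ@(hb , (_ , sharedₐ) , h≗ₐ) sub꜀@(hd , (_ , shared꜀) , h≗꜀) =
    subHeap-complement (⊆ʰ-trans (↾ʰ-⊆ʰ hc ha) (subHeap⇒⊆ʰ sub꜀))
      (sharedInStack-⊎ (sharedInStack-monoˡ r⊆ha sharedₐ)
                       (sharedInStack-monoˡ (↾ʰ-⊆ʰ hc ha) shared꜀) cover)
    where
    r : Heap
    r = hc ↾ʰ ha

    r⊆ha : r ⊆ʰ ha
    r⊆ha l v e with ↾ʰ-just hc ha e
    ... | (u , ha≡u) , hc≡v =
      trans ha≡u (trans (sym (subHeap⇒⊆ʰ subₐ l u ha≡u)) (subHeap⇒⊆ʰ sub꜀ l v hc≡v))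

    cover : (h ∖ʰ r) ⊆ʰ hb ⊎ʰ hd
    cover l v e with ∖ʰ-just h r e | hc l in hc≡
    ... | r≡nothing , h≡v | just u  =
      inj₁ (complement-just ha hb h≗ₐ (↾ʰ-nothing hc ha r≡nothing hc≡) h≡v)
    ... | _ , h≡v | nothing = inj₂ (complement-just hc hd h≗꜀ hc≡ h≡v)

  subHeap-∪ʰˡ : SepDefined s h₁ h₂ → SubHeap s h₁ (h₁ ∪ʰ h₂)
  subHeap-∪ʰˡ {h₂ = h₂} sep = h₂ , sep , λ _ → refl

  subHeap-∪ʰʳ : SepDefined s h₁ h₂ → SubHeap s h₂ (h₁ ∪ʰ h₂)
  subHeap-∪ʰʳ {h₁ = h₁} {h₂} sep = h₁ , SepDefined-sym sep , ∪ʰ-comm h₁ h₂ (proj₁ sep)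

  subHeap-chunk⁺ : SubHeap s ha h → Chunk s ha hc → Chunk s h hc
  subHeap-chunk⁺ subₐ (sub , nonempty , minimal) =
    subHeap-trans sub subₐ , nonempty ,
    λ (h′ , sub′ , nonempty′ , h′⊆hc , h′≉hc) →
      minimal (h′ , subHeap-shrink sub′ (⊆ʰ-trans h′⊆hc (subHeap⇒⊆ʰ sub)) (subHeap⇒⊆ʰ subₐ) ,
               nonempty′ , h′⊆hc , h′≉hc)

  subHeap-chunk⁻ : SubHeap s ha h → Chunk s h hc → hc ⊆ʰ ha → Chunk s ha hc
  subHeap-chunk⁻ subₐ (sub , nonempty , minimal) hc⊆ha =
    subHeap-shrink sub hc⊆ha (subHeap⇒⊆ʰ subₐ) , nonempty ,
    λ (h′ , sub′ , rest) → minimal (h′ , subHeap-trans sub′ subₐ , rest)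

  dom? : ∀ h l → Dec (dom h l)
  dom? h l with h l
  ... | just v  = yes (v , refl)
  ... | nothing = no λ ()

  meets? : FiniteHeap h → ∀ h′ → Dec (Σ Loc λ l → dom h l × dom h′ l)
  meets? {h} (domain , complete) h′ =
    map′ satisfied (λ (l , d , d′) → lose (complete l d) (d , d′))
         (any? (λ l → dom? h l ×-dec dom? h′ l) domain)

  -- The only use of finiteness: it makes "hc meets dom ha" decidable.
  chunk-⊆ʰ-⊎ : FiniteHeap ha → SepDefined s ha hb → Chunk s (ha ∪ʰ hb) hc → hc ⊆ʰ ha ⊎ hc ⊆ʰ hb
  chunk-⊆ʰ-⊎ {ha} {s} {hb} {hc} finite sep (sub , _ , minimal) with meets? finite hc
  ... | yes (l₀ , dₐ , (u , hc≡u)) = inj₁ hc⊆ha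
    where
    hc⊆ha : hc ⊆ʰ ha
    hc⊆ha l v hc≡v with ha l in ha≡
    ... | just _  = trans (sym (⊆ʰ-∪ʰˡ ha hb l _ ha≡)) (subHeap⇒⊆ʰ sub l v hc≡v)
    ... | nothing = ⊥-elim (minimal
      (hc ↾ʰ ha , subHeap-↾ʰ (subHeap-∪ʰˡ sep) sub , (l₀ , u , ↾ʰ-just⁺ hc ha dₐ hc≡u) ,
       ↾ʰ-⊆ʰ hc ha ,
       λ r≗hc → nothing≢just (trans (sym (↾ʰ-nothing⁺ hc ha ha≡)) (trans (r≗hc l) hc≡v))))
  ... | no disjoint = inj₂ hc⊆hb
    where
    hc⊆hb : hc ⊆ʰ hb
    hc⊆hb l v hc≡v with ha l in ha≡
    ... | just a  = ⊥-elim (disjoint (l , (a , ha≡) , (v , hc≡v)))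
    ... | nothing = trans (sym (∪ʰ-nothingˡ ha hb ha≡)) (subHeap⇒⊆ʰ sub l v hc≡v)

  chunk-∪ʰ : FiniteHeap h₁ → SepDefined s h₁ h₂ →
             ∀ hc → Chunk s (h₁ ∪ʰ h₂) hc ⇔ (Chunk s h₁ hc ⊎ Chunk s h₂ hc)
  chunk-∪ʰ finite sep hc =
    (λ ch → Sum.map (subHeap-chunk⁻ (subHeap-∪ʰˡ sep) ch) (subHeap-chunk⁻ (subHeap-∪ʰʳ sep) ch)
                    (chunk-⊆ʰ-⊎ finite sep ch)) ,
    [ subHeap-chunk⁺ (subHeap-∪ʰˡ sep) , subHeap-chunk⁺ (subHeap-∪ʰʳ sep) ]′

  ChunkDetermined : ∀ {p} → Stack → (Heap → Set p) → Set p
  ChunkDetermined s P = ∀ {h} → P h → Σ Heap λ hc → Chunk s h hc × (∀ {h′} → Chunk s h′ hc → P h′)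

  chunkDetermined-⊎ : ∀ {p} {P : Heap → Set p} → ChunkDetermined s P →
                      (∀ hc → Chunk s h hc ⇔ (Chunk s h₁ hc ⊎ Chunk s h₂ hc)) →
                      P h ⇔ (P h₁ ⊎ P h₂)
  chunkDetermined-⊎ determined split =
    (λ p → let hc , ch , transfer = determined p in
           Sum.map transfer transfer (proj₁ (split hc) ch)) ,
    [ (λ p → let hc , ch , transfer = determined p in transfer (proj₂ (split hc) (inj₁ ch))) ,
      (λ p → let hc , ch , transfer = determined p in transfer (proj₂ (split hc) (inj₂ ch))) ]′

  Eind-determined : ∀ b b′ l → ChunkDetermined s (λ h → Eind s h b b′ l)
  Eind-determined b b′ eq1 (x , y , dx , dy , bx , by , hc , (ch , τ) , x↦y) =
    hc , ch , λ ch′ → x , y , dx , dy , bx , by , hc , (ch′ , τ) , x↦y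
  Eind-determined b b′ geq2 (x , y , dx , dy , bx , by , hc , (ch , τ) , lsxy) =
    hc , ch , λ ch′ → x , y , dx , dy , bx , by , hc , (ch′ , τ) , lsxy

  NegChunk-determined : ∀ hc → ChunkDetermined s (λ h → NegChunk s h hc)
  NegChunk-determined hc (ch , ¬τ) = hc , ch , λ ch′ → ch′ , ¬τ

  Rind-determined : ∀ S → ChunkDetermined s (λ h → Rind s h S)
  Rind-determined S (hc , (ch , ¬τ) , blocks) = hc , ch , λ ch′ → hc , (ch′ , ¬τ) , blocks

  ≐-refl : b ≐ b
  ≐-refl _ = id , id

  chunkBlocks-mono : h ⊆ʰ h′ → chunkBlocks s h b → chunkBlocks s h′ b
  chunkBlocks-mono h⊆h′ (x , b≐x , l , sx , (v , e)) = x , b≐x , l , sx , (v , h⊆h′ l v e)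

  chunkBlocks-disjoint : SepDefined s h₁ h₂ → chunkBlocks s h₁ b → chunkBlocks s h₂ b′ → ¬ b ≐ b′
  chunkBlocks-disjoint {s} {h₂ = h₂} (disjoint , _) (x , b≐x , l , sx , d₁)
                       (x′ , b′≐x′ , l′ , sx′ , d₂) b≐b′ =
    disjoint l d₁ (subst (dom h₂) l′≡l d₂)
    where
    x∈[x′] : cls s x′ x
    x∈[x′] = proj₁ (b′≐x′ x) (proj₁ (b≐b′ x) (proj₂ (b≐x x) (l , sx , sx)))
    l′≡l : l′ ≡ l
    l′≡l with x∈[x′]
    ... | _ , sx′≡ , sx≡ = just-injective (trans (trans (sym sx′) sx′≡) (trans (sym sx≡) sx))

  Eind⇒chunkBlocks : ∀ l → Eind s h b b′ l → chunkBlocks s h b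
  Eind⇒chunkBlocks eq1 (x , _ , _ , _ , b≐x , _ , _ , ((sub , _) , _) ,
                        (l₀ , l₁ , sx , _ , hc≡ , _)) =
    x , b≐x , l₀ , sx , (l₁ , subHeap⇒⊆ʰ sub l₀ l₁ hc≡)
  Eind⇒chunkBlocks geq2 (_ , _ , _ , _ , _ , _ , _ , ((_ , (l , d) , _) , _) ,
                         inj₁ (empty , _) , _) =
    ⊥-elim (empty l d)
  Eind⇒chunkBlocks geq2 (x , _ , _ , _ , b≐x , _ , _ , ((sub , _) , _) ,
                         inj₂ (_ , ℓ , n≥1 , sx , _ , steps , _) , _) =
    x , b≐x , ℓ 0 , sx , (ℓ 1 , subHeap⇒⊆ʰ sub (ℓ 0) (ℓ 1) (steps 0 n≥1))

  Rind⇒chunkBlocks : ∀ {S} → Rind s h S → S b → chunkBlocks s h b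
  Rind⇒chunkBlocks (_ , ((sub , _) , _) , S≐ , _) Sb =
    chunkBlocks-mono (subHeap⇒⊆ʰ sub) (proj₁ (S≐ _) Sb)

  alloc⇒chunkBlocks : ∀ {A} → Abst s h A → Alloc A b → chunkBlocks s h b
  alloc⇒chunkBlocks (_ , E⇔ , _) (inj₁ (b′ , l , e))    = Eind⇒chunkBlocks l (proj₁ (E⇔ _ b′ l) e)
  alloc⇒chunkBlocks (_ , _ , R⇔ , _) (inj₂ (S , r , Sb)) = Rind⇒chunkBlocks (proj₁ (R⇔ S) r) Sb

  chunk-disjoint : SepDefined s h₁ h₂ → Chunk s h₁ h → Chunk s h₂ h′ → ¬ h ≗ʰ h′
  chunk-disjoint (disjoint , _) (sub , (l , v , e) , _) (sub′ , _) h≗h′ =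
    disjoint l (v , subHeap⇒⊆ʰ sub l v e) (v , subHeap⇒⊆ʰ sub′ l v (trans (sym (h≗h′ l)) e))

  Rind-disjoint : ∀ {S S′} → SepDefined s h₁ h₂ → Rind s h₁ S → Rind s h₂ S′ → ¬ S ≐₂ S′
  Rind-disjoint sep r@(_ , _ , _ , b , Sb) r′ S≐S′ =
    chunkBlocks-disjoint sep (Rind⇒chunkBlocks r Sb) (Rind⇒chunkBlocks r′ (proj₁ (S≐S′ b) Sb))
                         ≐-refl

  compatible : SepDefined s h₁ h₂ → Abst s h₁ A₁ → Abst s h₂ A₂ → Compatible A₁ A₂
  compatible sep abst₁ abst₂ =
    (λ b → ⇔-trans (proj₁ abst₁ b) (⇔-sym (proj₁ abst₂ b))) ,
    λ b b′ b≐b′ a₁ a₂ →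
      chunkBlocks-disjoint sep (alloc⇒chunkBlocks abst₁ a₁) (alloc⇒chunkBlocks abst₂ a₂) b≐b′

  abst-⊙ : SepDefined s h₁ h₂ → (∀ hc → Chunk s h hc ⇔ (Chunk s h₁ hc ⊎ Chunk s h₂ hc)) →
           Abst s h₁ A₁ → Abst s h₂ A₂ → Abst s h (A₁ ⊙ A₂)
  abst-⊙ {A₁ = A₁} {A₂ = A₂} sep split
         (V⇔ , E₁⇔ , R₁⇔ , n₁ , k₁ , negs₁ , rs₁ , n₁≡)
         (_  , E₂⇔ , R₂⇔ , n₂ , k₂ , negs₂ , rs₂ , n₂≡) =
    V⇔ ,
    (λ b b′ l → ⇔-trans (⊎-cong-⇔ (E₁⇔ b b′ l) (E₂⇔ b b′ l))
                        (⇔-sym (chunkDetermined-⊎ (Eind-determined b b′ l) split))) ,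
    (λ S → ⇔-trans (⊎-cong-⇔ (R₁⇔ S) (R₂⇔ S))
                   (⇔-sym (chunkDetermined-⊎ (Rind-determined S) split))) ,
    n₁ + n₂ , k₁ + k₂ ,
    HasCard-⊎ (λ h≗h′ l → sym (h≗h′ l))
              (λ neg₁ neg₂ → chunk-disjoint sep (proj₁ neg₁) (proj₁ neg₂))
              (λ hc → chunkDetermined-⊎ (NegChunk-determined hc) split) negs₁ negs₂ ,
    HasCard-⊎ (λ S≐S′ b → ⇔-sym (S≐S′ b)) (Rind-disjoint sep)
              (λ S → chunkDetermined-⊎ (Rind-determined S) split) rs₁ rs₂ ,
    trans (cong₂ _+_ n₁≡ n₂≡) (interchange (γ A₁) k₁ (γ A₂) k₂)

mainTheorem12 : (Loc Var : Set) (nil : Var) → InfiniteSet Loc → InfiniteSet Var →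
    let open SL Loc Var nil in
    (s : Stack) (h₁ h₂ : Heap) → Model s h₁ → Model s h₂ → SepDefined s h₁ h₂ →
    (A₁ A₂ : AMS) → Abst s h₁ A₁ → Abst s h₂ A₂ →
    Compatible A₁ A₂ × Abst s (h₁ ∪ʰ h₂) (A₁ ⊙ A₂)
mainTheorem12 Loc Var nil _ _ s h₁ h₂ (finite₁ , _) _ sep A₁ A₂ abst₁ abst₂ =
  compatible sep abst₁ abst₂ , abst-⊙ sep (chunk-∪ʰ finite₁ sep) abst₁ abst₂
  where open Abstraction Loc Var nil
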